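{- Let $\widehat G$ be a minimum interval supergraph of a graph $G$ and let $M$ be a connected module of $\widehat G$ such that $\widehat G[M]$ is not a clique. Then for any minimum interval supergraph $\widehat G_M$ of $G[M]$, the graph $\widehat G'$ obtained from $\widehat G$ by replacing the edges of $\widehat G[M]$ by the edges of $\widehat G_M$ (keeping all edges with at most one end in $M$) is a minimum interval supergraph of $G$. In particular, $\widehat G[M]$ is a minimum interval supergraph of $G[M]$.
   Context: Graphs are finite, simple, undirected. A set $M$ is a module of a graph $H$ if every vertex outside $M$ is adjacent to all or none of $M$; a connected module if moreover $H[M]$ is connected. An interval supergraph of $G$ is an interval graph on $V(G)$ containing all edges of $G$; it is minimum if it has the minimum number of edges among all interval supergraphs of $G$. -}

module Defs where

open import Data.Bool using (Bool; true; false; _∧_; if_then_else_)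
open import Data.Bool.Properties using (∧-comm)
open import Data.Nat using (ℕ; _≤_; _<ᵇ_)
open import Data.Fin using (Fin; toℕ)
open import Data.Fin.Subset using (Subset; _∈_; _∉_; ⊤)
open import Data.Vec using (lookup)
open import Data.List using (List; map)
open import Data.Nat.ListAction using (sum)
open import Data.List.Base using ()
open import Data.Product using (Σ; ∃; _×_; _,_)
open import Data.Sum using (_⊎_)
open import Function.Bundles using (_⇔_)
open import Relation.Nullary using (¬_)
open import Relation.Binary.PropositionalEquality using (_≡_; _≢_; refl; cong₂)

record Graph (n : ℕ) : Set where
  field
    adj    : Fin n → Fin n → Bool
    sym    : ∀ u v → adj u v ≡ adj v u
    irrefl : ∀ u → adj u u ≡ false
open Graph public

Adj : ∀ {n} → Graph n → Fin n → Fin n → Set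
Adj H u v = adj H u v ≡ true

vertices : (n : ℕ) → List (Fin n)
vertices n = Data.List.Base.tabulate {n = n} (λ i → i)

edgesOn : ∀ {n} → Subset n → Graph n → ℕ
edgesOn {n} S H =
  sum (map (λ u → sum (map (λ v →
        if (toℕ u <ᵇ toℕ v) ∧ lookup S u ∧ lookup S v ∧ adj H u v then 1 else 0)
      (vertices n))) (vertices n))

IsIntervalOn : ∀ {n} → Subset n → Graph n → Set
IsIntervalOn {n} S H =
  Σ (Fin n → ℕ) λ l → Σ (Fin n → ℕ) λ r →
    (∀ v → v ∈ S → l v ≤ r v) ×
    (∀ u v → u ∈ S → v ∈ S → u ≢ v → (Adj H u v ⇔ (l u ≤ r v × l v ≤ r u)))

SupergraphOn : ∀ {n} → Subset n → Graph n → Graph n → Set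
SupergraphOn S G H = ∀ u v → u ∈ S → v ∈ S → Adj G u v → Adj H u v

IsMinIntervalSupergraphOn : ∀ {n} → Subset n → Graph n → Graph n → Set
IsMinIntervalSupergraphOn {n} S G H =
  IsIntervalOn S H × SupergraphOn S G H ×
  (∀ (H' : Graph n) → IsIntervalOn S H' → SupergraphOn S G H' →
     edgesOn S H ≤ edgesOn S H')

IsMinIntervalSupergraph : ∀ {n} → Graph n → Graph n → Set
IsMinIntervalSupergraph G H = IsMinIntervalSupergraphOn ⊤ G H

IsModule : ∀ {n} → Graph n → Subset n → Set
IsModule H M =
  ∀ v → v ∉ M → (∀ u → u ∈ M → Adj H v u) ⊎ (∀ u → u ∈ M → ¬ Adj H v u)

data ReachIn {n} (H : Graph n) (M : Subset n) : Fin n → Fin n → Set where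
  here : ∀ {u} → u ∈ M → ReachIn H M u u
  step : ∀ {u w v} → u ∈ M → Adj H u w → ReachIn H M w v → ReachIn H M u v

IsConnectedOn : ∀ {n} → Graph n → Subset n → Set
IsConnectedOn H M = ∀ u v → u ∈ M → v ∈ M → ReachIn H M u v

IsConnectedModule : ∀ {n} → Graph n → Subset n → Set
IsConnectedModule H M = IsModule H M × IsConnectedOn H M

IsCliqueOn : ∀ {n} → Graph n → Subset n → Set
IsCliqueOn H M = ∀ u v → u ∈ M → v ∈ M → u ≢ v → Adj H u v

replace : ∀ {n} → Graph n → Subset n → Graph n → Graph n
replace {n} H M HM = record
  { adj    = a
  ; sym    = s
  ; irrefl = i
  }
  where
  a : Fin n → Fin n → Bool
  a u v = if lookup M u ∧ lookup M v then adj HM u v else adj H u v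
  s : ∀ u v → a u v ≡ a v u
  s u v rewrite ∧-comm (lookup M u) (lookup M v)
    with lookup M v ∧ lookup M u
  ... | true  = sym HM u v
  ... | false = sym H u v
  i : ∀ u → a u u ≡ false
  i u with lookup M u ∧ lookup M u
  ... | true  = irrefl HM u
  ... | false = irrefl H u

-- Write Ĝ′ for the graph obtained by the replacement.  Edge counts satisfy
-- |E(Ĝ′)| + |E(Ĝ[M])| = |E(Ĝ)| + |E(ĜM[M])|, so once Ĝ′ is known to be an
-- interval supergraph of G, minimality of Ĝ and of ĜM forces equality on both
-- sides.  Ĝ′ is an interval graph: as M is not a clique, its outside neighbours
-- are pairwise adjacent (else an induced 4-cycle appears), so an interval model
-- of Ĝ can be changed to put all of M on a single point lying in the intervals
-- of exactly the neighbours of M; blowing this point up into a scaled copy of an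
-- interval model of ĜM[M] gives a model of Ĝ′.

module Submission where

open import Defs hiding (sym)
open import Data.Bool using (Bool; true; false; _∧_; if_then_else_)
open import Data.Bool.Properties using () renaming (_≟_ to _≟ᵇ_)
open import Data.Empty using (⊥-elim)
open import Data.Fin using (Fin; toℕ)
import Data.Fin as Fin
open import Data.Fin.Subset using (Subset; _∈_; _∉_; ⊤; Nonempty)
open import Data.Fin.Subset.Properties using (_∈?_; ∈⊤; nonempty?)
open import Data.List using (List; []; _∷_; map)
open import Data.List.Properties using (map-cong)
open import Data.Nat using (ℕ; zero; suc; _+_; _*_; _≤_; _<_; _<ᵇ_; _⊓_; _⊔_; z≤n; _≤?_)
open import Data.Nat.ListAction using (sum)
open import Data.Nat.Properties
open import Algebra.Properties.CommutativeSemigroup +-commutativeSemigroup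
  using (interchange)
open import Data.Product using (∃; _×_; _,_; proj₁; proj₂; swap)
open import Data.Product.Function.NonDependent.Propositional using (_×-⇔_)
open import Data.Sum using (_⊎_; inj₁; inj₂; [_,_])
open import Data.Vec using (lookup)
open import Data.Vec.Properties using (lookup-replicate; []=⇒lookup; lookup⇒[]=)
open import Function using (_∘_; const)
open import Function.Bundles using (_⇔_; mk⇔; Equivalence)
open import Function.Construct.Composition using (_⇔-∘_)
open import Function.Construct.Symmetry using (⇔-sym)
open import Relation.Nullary using (¬_; Dec; yes; no; contradiction)
open import Relation.Nullary.Decidable using (decidable-stable)
open import Relation.Binary.PropositionalEquality
  using (_≡_; _≢_; ≢-sym; refl; sym; trans; cong; subst; module ≡-Reasoning)

open Equivalence using (to; from)

private
  variable
    n : ℕ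

sum-map-+ : ∀ {A : Set} (f g : A → ℕ) (xs : List A) →
  sum (map (λ x → f x + g x) xs) ≡ sum (map f xs) + sum (map g xs)
sum-map-+ f g []       = refl
sum-map-+ f g (x ∷ xs) = trans (cong (f x + g x +_) (sum-map-+ f g xs))
                               (interchange (f x) (g x) _ _)

sum-map-+-cong : ∀ {A : Set} {f g f′ g′ : A → ℕ} →
  (∀ x → f x + g x ≡ f′ x + g′ x) → ∀ xs →
  sum (map f xs) + sum (map g xs) ≡ sum (map f′ xs) + sum (map g′ xs)
sum-map-+-cong {f = f} {g} {f′} {g′} eq xs = begin
  sum (map f xs) + sum (map g xs)       ≡⟨ sum-map-+ f g xs ⟨
  sum (map (λ x → f x + g x) xs)       ≡⟨ cong sum (map-cong eq xs) ⟩
  sum (map (λ x → f′ x + g′ x) xs)     ≡⟨ sum-map-+ f′ g′ xs ⟩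
  sum (map f′ xs) + sum (map g′ xs)     ∎
  where open ≡-Reasoning

indicator : Bool → ℕ
indicator b = if b then 1 else 0

indicator-replace : ∀ t a b g h →
  indicator (t ∧ (if a ∧ b then h else g)) + indicator (t ∧ a ∧ b ∧ g) ≡
  indicator (t ∧ g) + indicator (t ∧ a ∧ b ∧ h)
indicator-replace false a     b     g h = refl
indicator-replace true  false b     g h = refl
indicator-replace true  true  false g h = refl
indicator-replace true  true  true  g h = +-comm (indicator h) (indicator g)

edgesOn-replace : ∀ (H HM : Graph n) (M : Subset n) →
  edgesOn ⊤ (replace H M HM) + edgesOn M H ≡ edgesOn ⊤ H + edgesOn M HM
edgesOn-replace {n} H HM M =
  sum-map-+-cong (λ u → sum-map-+-cong (pair u) (vertices n)) (vertices n)
  where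
  pair : ∀ u v →
    indicator ((toℕ u <ᵇ toℕ v) ∧ lookup ⊤ u ∧ lookup ⊤ v ∧ adj (replace H M HM) u v) +
    indicator ((toℕ u <ᵇ toℕ v) ∧ lookup M u ∧ lookup M v ∧ adj H u v) ≡
    indicator ((toℕ u <ᵇ toℕ v) ∧ lookup ⊤ u ∧ lookup ⊤ v ∧ adj H u v) +
    indicator ((toℕ u <ᵇ toℕ v) ∧ lookup M u ∧ lookup M v ∧ adj HM u v)
  pair u v rewrite lookup-replicate u true | lookup-replicate v true =
    indicator-replace (toℕ u <ᵇ toℕ v) (lookup M u) (lookup M v) (adj H u v) (adj HM u v)

+-exchange-≤ : ∀ {a b c d} → a + b ≡ c + d → d ≤ b → c ≤ a → a ≤ c × b ≤ d
+-exchange-≤ {a} {b} {c} {d} eq d≤b c≤a =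
  +-cancelʳ-≤ b a c (subst (_≤ c + b) (sym eq) (+-monoʳ-≤ c d≤b)) ,
  +-cancelˡ-≤ c b d (subst (c + b ≤_) eq (+-monoˡ-≤ b c≤a))

module _ (H HM : Graph n) {M : Subset n} {u v : Fin n} where

  adj-replace-inside : u ∈ M → v ∈ M → adj (replace H M HM) u v ≡ adj HM u v
  adj-replace-inside u∈M v∈M rewrite []=⇒lookup u∈M | []=⇒lookup v∈M = refl

  adj-replace-outside : u ∉ M ⊎ v ∉ M → adj (replace H M HM) u v ≡ adj H u v
  adj-replace-outside outside with lookup M u in eu | lookup M v in ev
  ... | false | _     = refl
  ... | true  | false = refl
  ... | true  | true  =
    ⊥-elim ([ (λ u∉M → u∉M (lookup⇒[]= u M eu)) , (λ v∉M → v∉M (lookup⇒[]= v M ev)) ] outside)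

replace-supergraph : ∀ {G H HM : Graph n} {M : Subset n} →
  SupergraphOn ⊤ G H → SupergraphOn M G HM → SupergraphOn ⊤ G (replace H M HM)
replace-supergraph {H = H} {HM} {M} G⊆H G⊆HM u v _ _ uv with u ∈? M | v ∈? M
... | yes u∈M | yes v∈M = trans (adj-replace-inside H HM u∈M v∈M) (G⊆HM u v u∈M v∈M uv)
... | no  u∉M | _       = trans (adj-replace-outside H HM (inj₁ u∉M)) (G⊆H u v ∈⊤ ∈⊤ uv)
... | yes _   | no  v∉M = trans (adj-replace-outside H HM (inj₂ v∉M)) (G⊆H u v ∈⊤ ∈⊤ uv)

Meet : (Fin n → ℕ) → (Fin n → ℕ) → Fin n → Fin n → Set
Meet l r u v = l u ≤ r v × l v ≤ r u

module _ {l r : Fin n → ℕ} where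

  ¬Meet⇒separated : ∀ {u v} → ¬ Meet l r u v → r v < l u ⊎ r u < l v
  ¬Meet⇒separated {u} {v} ¬uv with l u ≤? r v | l v ≤? r u
  ... | no  lu≰rv | _         = inj₁ (≰⇒> lu≰rv)
  ... | yes _     | no  lv≰ru = inj₂ (≰⇒> lv≰ru)
  ... | yes lu≤rv | yes lv≤ru = contradiction (lu≤rv , lv≤ru) ¬uv

  -- Both b and d contain the gap between the disjoint intervals of a and c.
  commonNeighbours-Meet : ∀ {a b c d} → ¬ Meet l r a c →
    Meet l r b a → Meet l r b c → Meet l r d a → Meet l r d c → Meet l r b d
  commonNeighbours-Meet ¬ac ba bc da dc with ¬Meet⇒separated ¬ac
  ... | inj₁ rc<la = <⇒≤ (≤-<-trans (proj₁ bc) (<-≤-trans rc<la (proj₂ da))) ,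
                     <⇒≤ (≤-<-trans (proj₁ dc) (<-≤-trans rc<la (proj₂ ba)))
  ... | inj₂ ra<lc = <⇒≤ (≤-<-trans (proj₁ ba) (<-≤-trans ra<lc (proj₂ dc))) ,
                     <⇒≤ (≤-<-trans (proj₁ da) (<-≤-trans ra<lc (proj₂ bc)))

Adj? : ∀ (H : Graph n) u v → Dec (Adj H u v)
Adj? H u v = adj H u v ≟ᵇ true

Adj-flip : ∀ (H : Graph n) {u v} {A B : Set} →
  Adj H v u ⇔ (A × B) → Adj H u v ⇔ (B × A)
Adj-flip H {u} {v} vu⇔ =
  mk⇔ (swap ∘ to vu⇔ ∘ trans (Graph.sym H v u)) (trans (Graph.sym H u v) ∘ from vu⇔ ∘ swap)

Adj-cong : ∀ {H H′ : Graph n} {u v} → adj H u v ≡ adj H′ u v → Adj H u v ⇔ Adj H′ u v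
Adj-cong eq = mk⇔ (trans (sym eq)) (trans eq)

both-hold : ∀ {A B C : Set} → A → B → C → A ⇔ (B × C)
both-hold a b c = mk⇔ (const (b , c)) (const a)

both-fail : ∀ {A B : Set} → ¬ A → ¬ B → A ⇔ B
both-fail ¬a ¬b = mk⇔ (⊥-elim ∘ ¬a) (⊥-elim ∘ ¬b)

∉-∈⇒≢ : ∀ {M : Subset n} {u v} → u ∉ M → v ∈ M → u ≢ v
∉-∈⇒≢ u∉M v∈M refl = u∉M v∈M

-- Otherwise two common outside neighbours u, v of non-adjacent y, z ∈ M would
-- form an induced 4-cycle u y v z, which no interval graph contains.
outsideNeighbours-adjacent : ∀ {H : Graph n} {M : Subset n} {l r : Fin n → ℕ} →
  (∀ u v → u ≢ v → Adj H u v ⇔ Meet l r u v) → ¬ IsCliqueOn H M →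
  ∀ {u v} → u ∉ M → v ∉ M → u ≢ v →
  (∀ y → y ∈ M → Adj H u y) → (∀ y → y ∈ M → Adj H v y) → Adj H u v
outsideNeighbours-adjacent {H = H} {M} {l} {r} model nonClique {u} {v} u∉M v∉M u≢v u~M v~M =
  decidable-stable (Adj? H u v) λ ¬uv →
    nonClique λ y z y∈M z∈M y≢z → decidable-stable (Adj? H y z) λ ¬yz →
      ¬yz (from (model y z y≢z)
        (commonNeighbours-Meet {l = l} {r} (¬uv ∘ from (model u v u≢v))
          (meets u∉M u~M y∈M) (meets v∉M v~M y∈M) (meets u∉M u~M z∈M) (meets v∉M v~M z∈M)))
  where
  meets : ∀ {w y} → w ∉ M → (∀ y → y ∈ M → Adj H w y) → y ∈ M → Meet l r y w
  meets {w} {y} w∉M w~M y∈M = swap (to (model w y (∉-∈⇒≢ w∉M y∈M)) (w~M y y∈M))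

m⊓n≤o⇒o<n⇒m≤o : ∀ {m n o} → m ⊓ n ≤ o → o < n → m ≤ o
m⊓n≤o⇒o<n⇒m≤o {m} {n} {o} m⊓n≤o o<n with ⊓-sel m n
... | inj₁ m⊓n≡m = subst (_≤ o) m⊓n≡m m⊓n≤o
... | inj₂ m⊓n≡n = contradiction (subst (_≤ o) m⊓n≡n m⊓n≤o) (<⇒≱ o<n)

-- Every vertex of M becomes the point l x; the outside neighbours of M, which
-- already meet the interval of x, are stretched to the left to contain l x.
module Collapse {H : Graph n} {M : Subset n} {l r : Fin n → ℕ}
  (l≤r : ∀ v → l v ≤ r v)
  (model : ∀ u v → u ≢ v → Adj H u v ⇔ Meet l r u v)
  (isModule : IsModule H M) (nonClique : ¬ IsCliqueOn H M)
  {x : Fin n} (x∈M : x ∈ M) where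

  data Position (v : Fin n) : Set where
    member   : v ∈ M → Position v
    attached : v ∉ M → Adj H v x → Position v
    detached : v ∉ M → ¬ Adj H v x → Position v

  position : ∀ v → Position v
  position v with v ∈? M | Adj? H v x
  ... | yes v∈M | _        = member v∈M
  ... | no  v∉M | yes vx   = attached v∉M vx
  ... | no  v∉M | no  ¬vx  = detached v∉M ¬vx

  left right : ∀ {v} → Position v → ℕ
  left      (member _)     = l x
  left {v}  (attached _ _) = l v ⊓ l x
  left {v}  (detached _ _) = l v
  right     (member _)     = l x
  right {v} (attached _ _) = r v
  right {v} (detached _ _) = r v

  left≤right : ∀ {v} (p : Position v) → left p ≤ right p
  left≤right     (member _)     = ≤-refl
  left≤right {v} (attached _ _) = ≤-trans (m⊓n≤m (l v) (l x)) (l≤r v)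
  left≤right {v} (detached _ _) = l≤r v

  member-point : ∀ {v} → v ∈ M → (p : Position v) → left p ≡ l x × right p ≡ l x
  member-point v∈M (member _)       = refl , refl
  member-point v∈M (attached v∉M _) = contradiction v∈M v∉M
  member-point v∈M (detached v∉M _) = contradiction v∈M v∉M

  meets-x : ∀ {v} → v ∉ M → Adj H v x → Meet l r v x
  meets-x v∉M = to (model _ x (∉-∈⇒≢ v∉M x∈M))

  adjacent-to-M : ∀ {v y} → v ∉ M → Adj H v x → y ∈ M → Adj H v y
  adjacent-to-M v∉M vx y∈M =
    [ (λ all → all _ y∈M) , (λ none → contradiction vx (none x x∈M)) ] (isModule _ v∉M)

  nonadjacent-to-M : ∀ {v y} → v ∉ M → ¬ Adj H v x → y ∈ M → ¬ Adj H v y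
  nonadjacent-to-M v∉M ¬vx y∈M =
    [ (λ all → contradiction (all x x∈M) ¬vx) , (λ none → none _ y∈M) ] (isModule _ v∉M)

  member-attached : ∀ {u v} → u ∈ M → v ∉ M → Adj H v x →
    Adj H u v ⇔ (l x ≤ r v × l v ⊓ l x ≤ l x)
  member-attached {u} {v} u∈M v∉M vx =
    both-hold (trans (Graph.sym H u v) (adjacent-to-M v∉M vx u∈M))
              (proj₂ (meets-x v∉M vx)) (m⊓n≤n (l v) (l x))

  member-detached : ∀ {u v} → u ∈ M → v ∉ M → ¬ Adj H v x →
    Adj H u v ⇔ (l x ≤ r v × l v ≤ l x)
  member-detached {u} {v} u∈M v∉M ¬vx =
    both-fail (λ uv → nonadjacent-to-M v∉M ¬vx u∈M (trans (Graph.sym H v u) uv))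
              (λ (lx≤rv , lv≤lx) → ¬vx (from (model v x (∉-∈⇒≢ v∉M x∈M))
                                          (≤-trans lv≤lx (l≤r x) , lx≤rv)))

  attached-attached : ∀ {u v} → u ≢ v → u ∉ M → Adj H u x → v ∉ M → Adj H v x →
    Adj H u v ⇔ (l u ⊓ l x ≤ r v × l v ⊓ l x ≤ r u)
  attached-attached {u} {v} u≢v u∉M ux v∉M vx =
    both-hold (outsideNeighbours-adjacent {H = H} model nonClique u∉M v∉M u≢v
                 (λ _ → adjacent-to-M u∉M ux) (λ _ → adjacent-to-M v∉M vx))
              (≤-trans (m⊓n≤n (l u) (l x)) (proj₂ (meets-x v∉M vx)))
              (≤-trans (m⊓n≤n (l v) (l x)) (proj₂ (meets-x u∉M ux)))

  -- The interval of v lies entirely to one side of that of x, which u meets.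
  attached-detached : ∀ {u v} → u ≢ v → u ∉ M → Adj H u x → v ∉ M → ¬ Adj H v x →
    Adj H u v ⇔ (l u ⊓ l x ≤ r v × l v ≤ r u)
  attached-detached {u} {v} u≢v u∉M ux v∉M ¬vx =
    mk⇔ (λ uv → let (lu≤rv , lv≤ru) = to (model u v u≢v) uv
                in ≤-trans (m⊓n≤m (l u) (l x)) lu≤rv , lv≤ru)
        (λ (p , lv≤ru) → from (model u v u≢v) (stretched p , lv≤ru))
    where
    stretched : l u ⊓ l x ≤ r v → l u ≤ r v
    stretched p with ¬Meet⇒separated {l = l} {r} (¬vx ∘ from (model v x (∉-∈⇒≢ v∉M x∈M)))
    ... | inj₁ rx<lv = <⇒≤ (≤-<-trans (proj₁ (meets-x u∉M ux)) (<-≤-trans rx<lv (l≤r v)))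
    ... | inj₂ rv<lx = m⊓n≤o⇒o<n⇒m≤o p rv<lx

  position-model : ∀ {u v} → u ≢ v → u ∉ M ⊎ v ∉ M → (p : Position u) (q : Position v) →
    Adj H u v ⇔ (left p ≤ right q × left q ≤ right p)
  position-model _   out (member u∈M) (member v∈M) =
    ⊥-elim ([ (λ u∉M → u∉M u∈M) , (λ v∉M → v∉M v∈M) ] out)
  position-model _   _ (member u∈M)       (attached v∉M vx)  = member-attached u∈M v∉M vx
  position-model _   _ (member u∈M)       (detached v∉M ¬vx) = member-detached u∈M v∉M ¬vx
  position-model _   _ (attached u∉M ux)  (member v∈M)       = Adj-flip H (member-attached v∈M u∉M ux)
  position-model u≢v _ (attached u∉M ux)  (attached v∉M vx)  = attached-attached u≢v u∉M ux v∉M vx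
  position-model u≢v _ (attached u∉M ux)  (detached v∉M ¬vx) = attached-detached u≢v u∉M ux v∉M ¬vx
  position-model _   _ (detached u∉M ¬ux) (member v∈M)       = Adj-flip H (member-detached v∈M u∉M ¬ux)
  position-model u≢v _ (detached u∉M ¬ux) (attached v∉M vx)  =
    Adj-flip H (attached-detached (≢-sym u≢v) v∉M vx u∉M ¬ux)
  position-model {u} {v} u≢v _ (detached _ _) (detached _ _) = model u v u≢v

bounded : (f : Fin n → ℕ) → ∃ λ K → ∀ v → f v ≤ K
bounded {zero}  f = 0 , λ ()
bounded {suc n} f with bounded (f ∘ Fin.suc)
... | K , f≤K = f Fin.zero ⊔ K , λ where
  Fin.zero    → m≤m⊔n (f Fin.zero) K
  (Fin.suc v) → ≤-trans (f≤K v) (m≤n⊔m (f Fin.zero) K)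

-- Reading a * (K + 1) + i with i ≤ K as the pair (a , i) in lexicographic order.
scaled-≤⇔ : ∀ {K a b i j} → i ≤ j → j ≤ K → (a * suc K + i ≤ b * suc K + j ⇔ a ≤ b)
scaled-≤⇔ {K} {a} {b} {i} {j} i≤j j≤K =
  mk⇔ scaled⇒ (λ a≤b → +-mono-≤ (*-monoˡ-≤ (suc K) a≤b) i≤j)
  where
  scaled⇒ : a * suc K + i ≤ b * suc K + j → a ≤ b
  scaled⇒ le with a ≤? b
  ... | yes a≤b = a≤b
  ... | no  a≰b = contradiction le (<⇒≱ (begin-strict
    b * suc K + j      ≤⟨ +-monoʳ-≤ (b * suc K) j≤K ⟩
    b * suc K + K      <⟨ +-monoʳ-< (b * suc K) (n<1+n K) ⟩
    b * suc K + suc K  ≡⟨ +-comm (b * suc K) (suc K) ⟩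
    suc b * suc K      ≤⟨ *-monoˡ-≤ (suc K) (≰⇒> a≰b) ⟩
    a * suc K          ≤⟨ m≤m+n (a * suc K) i ⟩
    a * suc K + i      ∎))
    where open ≤-Reasoning

-- Each vertex v keeps its interval [l v, r v] as the coarse coordinate; the fine
-- coordinate is [lM v, rM v] inside M and the whole range [0, K] outside.
module Substitution {H HM : Graph n} {M : Subset n} {l r : Fin n → ℕ} {a : ℕ}
  (l≤r : ∀ v → l v ≤ r v)
  (point : ∀ v → v ∈ M → l v ≡ a × r v ≡ a)
  (model : ∀ u v → u ≢ v → u ∉ M ⊎ v ∉ M → Adj H u v ⇔ Meet l r u v)
  {lM rM : Fin n → ℕ}
  (lM≤rM : ∀ v → v ∈ M → lM v ≤ rM v)
  (modelM : ∀ u v → u ∈ M → v ∈ M → u ≢ v → Adj HM u v ⇔ Meet lM rM u v) where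

  K : ℕ
  K = proj₁ (bounded rM)

  rM≤K : ∀ v → rM v ≤ K
  rM≤K = proj₂ (bounded rM)

  fineL fineR : Fin n → ℕ
  fineL v with v ∈? M
  ... | yes _ = lM v
  ... | no  _ = 0
  fineR v with v ∈? M
  ... | yes _ = rM v
  ... | no  _ = K

  L R : Fin n → ℕ
  L v = l v * suc K + fineL v
  R v = r v * suc K + fineR v

  fineR≤K : ∀ v → fineR v ≤ K
  fineR≤K v with v ∈? M
  ... | yes _ = rM≤K v
  ... | no  _ = ≤-refl

  fineL≤fineR : ∀ v → fineL v ≤ fineR v
  fineL≤fineR v with v ∈? M
  ... | yes v∈M = lM≤rM v v∈M
  ... | no  _   = z≤n

  fineL≤fineR-outside : ∀ {u v} → u ∉ M ⊎ v ∉ M → fineL u ≤ fineR v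
  fineL≤fineR-outside {u} {v} out with u ∈? M | v ∈? M
  ... | yes u∈M | yes v∈M = ⊥-elim ([ (λ u∉M → u∉M u∈M) , (λ v∉M → v∉M v∈M) ] out)
  ... | yes u∈M | no  _   = ≤-trans (lM≤rM u u∈M) (rM≤K u)
  ... | no  _   | _       = z≤n

  L≤R : ∀ v → L v ≤ R v
  L≤R v = from (scaled-≤⇔ (fineL≤fineR v) (fineR≤K v)) (l≤r v)

  Meet-outside : ∀ {u v} → u ∉ M ⊎ v ∉ M → Meet L R u v ⇔ Meet l r u v
  Meet-outside {u} {v} out =
    scaled-≤⇔ (fineL≤fineR-outside out) (fineR≤K v) ×-⇔
    scaled-≤⇔ (fineL≤fineR-outside (Data.Sum.swap out)) (fineR≤K u)

  Meet-inside : ∀ {u v} → u ∈ M → v ∈ M → Meet L R u v ⇔ Meet lM rM u v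
  Meet-inside {u} {v} u∈M v∈M with u ∈? M | v ∈? M
  ... | no u∉M | _      = contradiction u∈M u∉M
  ... | yes _  | no v∉M = contradiction v∈M v∉M
  ... | yes _  | yes _
    rewrite proj₁ (point u u∈M) | proj₂ (point u u∈M)
          | proj₁ (point v v∈M) | proj₂ (point v v∈M) = shift ×-⇔ shift
    where
    shift : ∀ {i j} → a * suc K + i ≤ a * suc K + j ⇔ i ≤ j
    shift = mk⇔ (+-cancelˡ-≤ (a * suc K) _ _) (+-monoʳ-≤ (a * suc K))

  replace-model-inside : ∀ {u v} → u ≢ v → u ∈ M → v ∈ M →
    Adj (replace H M HM) u v ⇔ Meet L R u v
  replace-model-inside {u} {v} u≢v u∈M v∈M =
    ⇔-sym (Meet-inside u∈M v∈M) ⇔-∘ (modelM u v u∈M v∈M u≢v ⇔-∘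
      Adj-cong {H = replace H M HM} {HM} (adj-replace-inside H HM u∈M v∈M))

  replace-model-outside : ∀ {u v} → u ≢ v → u ∉ M ⊎ v ∉ M →
    Adj (replace H M HM) u v ⇔ Meet L R u v
  replace-model-outside {u} {v} u≢v out =
    ⇔-sym (Meet-outside out) ⇔-∘ (model u v u≢v out ⇔-∘
      Adj-cong {H = replace H M HM} {H} (adj-replace-outside H HM out))

  replace-model : ∀ u v → u ≢ v → Adj (replace H M HM) u v ⇔ Meet L R u v
  replace-model u v u≢v = byMembership (u ∈? M) (v ∈? M)
    where
    byMembership : Dec (u ∈ M) → Dec (v ∈ M) → Adj (replace H M HM) u v ⇔ Meet L R u v
    byMembership (yes u∈M) (yes v∈M) = replace-model-inside u≢v u∈M v∈M
    byMembership (no  u∉M) _         = replace-model-outside u≢v (inj₁ u∉M)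
    byMembership (yes _)   (no  v∉M) = replace-model-outside u≢v (inj₂ v∉M)

  replace-isIntervalOn : IsIntervalOn ⊤ (replace H M HM)
  replace-isIntervalOn = L , R , (λ v _ → L≤R v) , (λ u v _ _ → replace-model u v)

IsIntervalOn-restrict : ∀ {H : Graph n} {S : Subset n} → IsIntervalOn ⊤ H → IsIntervalOn S H
IsIntervalOn-restrict (l , r , l≤r , model) =
  l , r , (λ v _ → l≤r v ∈⊤) , (λ u v _ _ → model u v ∈⊤ ∈⊤)

SupergraphOn-restrict : ∀ {G H : Graph n} {S : Subset n} → SupergraphOn ⊤ G H → SupergraphOn S G H
SupergraphOn-restrict G⊆H u v _ _ = G⊆H u v ∈⊤ ∈⊤

nonClique⇒nonempty : ∀ {H : Graph n} {M : Subset n} → ¬ IsCliqueOn H M → Nonempty M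
nonClique⇒nonempty {M = M} nonClique = decidable-stable (nonempty? M) λ empty →
  nonClique λ u _ u∈M _ _ → contradiction (u , u∈M) empty

theorem4 : ∀ {n : ℕ} (G Ĝ : Graph n) (M : Subset n)
    → IsMinIntervalSupergraph G Ĝ
    → IsConnectedModule Ĝ M
    → ¬ IsCliqueOn Ĝ M
    → ∀ (ĜM : Graph n) → IsMinIntervalSupergraphOn M G ĜM
    → IsMinIntervalSupergraph G (replace Ĝ M ĜM) × IsMinIntervalSupergraphOn M G Ĝ
theorem4 G Ĝ M (Ĝ-interval@(l , r , l≤r , model) , G⊆Ĝ , Ĝ-minimum) (isModule , _) nonClique
         ĜM ((lM , rM , lM≤rM , modelM) , G⊆ĜM , ĜM-minimum) =
  (replace-isIntervalOn , replaced-supergraph , λ H′ i s → ≤-trans replaced≤Ĝ (Ĝ-minimum H′ i s)) ,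
  (Ĝ-interval-on-M , G⊆Ĝ-on-M , λ H′ i s → ≤-trans Ĝ≤ĜM-on-M (ĜM-minimum H′ i s))
  where
  open Collapse {H = Ĝ} (λ v → l≤r v ∈⊤) (λ u v → model u v ∈⊤ ∈⊤) isModule nonClique
                (proj₂ (nonClique⇒nonempty {H = Ĝ} nonClique))
  open Substitution {H = Ĝ} {HM = ĜM}
    (λ v → left≤right (position v)) (λ v v∈M → member-point v∈M (position v))
    (λ u v u≢v out → position-model u≢v out (position u) (position v)) lM≤rM modelM

  replaced-supergraph : SupergraphOn ⊤ G (replace Ĝ M ĜM)
  replaced-supergraph = replace-supergraph {G = G} {Ĝ} {ĜM} G⊆Ĝ G⊆ĜM

  Ĝ-interval-on-M : IsIntervalOn M Ĝ
  Ĝ-interval-on-M = IsIntervalOn-restrict {H = Ĝ} Ĝ-interval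

  G⊆Ĝ-on-M : SupergraphOn M G Ĝ
  G⊆Ĝ-on-M = SupergraphOn-restrict {G = G} {Ĝ} G⊆Ĝ

  exchanged : edgesOn ⊤ (replace Ĝ M ĜM) ≤ edgesOn ⊤ Ĝ × edgesOn M Ĝ ≤ edgesOn M ĜM
  exchanged = +-exchange-≤ (edgesOn-replace Ĝ ĜM M)
    (ĜM-minimum Ĝ Ĝ-interval-on-M G⊆Ĝ-on-M)
    (Ĝ-minimum (replace Ĝ M ĜM) replace-isIntervalOn replaced-supergraph)

  replaced≤Ĝ : edgesOn ⊤ (replace Ĝ M ĜM) ≤ edgesOn ⊤ Ĝ
  replaced≤Ĝ = proj₁ exchanged

  Ĝ≤ĜM-on-M : edgesOn M Ĝ ≤ edgesOn M ĜM
  Ĝ≤ĜM-on-M = proj₂ exchanged
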